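{- For integers $n$ and $d$ with $3\le d\le\lfloor n/2\rfloor-1$, we have $M^{[2]}(d,n)\le\lceil n/2\rceil+2d-3$.
   Context: Group testing setting: a population of $n$ items contains exactly $d$ defective items, where $d$ is known in advance. A test is applied to a subset of the population and its outcome is positive if the subset contains at least one defective item and negative otherwise. Tests are performed sequentially (adaptively): the result of each test is known before the next test is chosen. An algorithm solves the $(d,n)$-problem if it always identifies the set of defective items. $M^{[k]}(d,n)$ denotes the minimum, over all such sequential algorithms in which every tested subset has size exactly $k$, of the worst-case number of tests used; if no such algorithm exists, $M^{[k]}(d,n)=\infty$. -}

module Defs where

open import Data.Nat using (ℕ; zero; suc; _+_; _≤_)
open import Data.Bool using (Bool; true; false; _∧_; _∨_)
open import Data.Vec using (Vec; []; _∷_)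
open import Data.Fin.Subset using (Subset; ∣_∣)
open import Data.Product using (Σ; _×_)
open import Relation.Binary.PropositionalEquality using (_≡_)

-- Outcome of testing the set S when the defective set is D:
-- true (positive) iff S ∩ D is nonempty.
meets : ∀ {n} → Subset n → Subset n → Bool
meets [] [] = false
meets (x ∷ xs) (y ∷ ys) = (x ∧ y) ∨ meets xs ys

-- A sequential (adaptive) group-testing algorithm on n items is a
-- decision tree: either it stops and outputs a candidate defective set,
-- or it tests a subset S and continues in the positive / negative branch.
data Alg (n : ℕ) : Set where
  answer : Subset n → Alg n
  test   : (S : Subset n) → (pos neg : Alg n) → Alg n

output : ∀ {n} → Alg n → Subset n → Subset n
output (answer A) D = A
output (test S p q) D with meets S D
... | true  = output p D
... | false = output q D

testsUsed : ∀ {n} → Alg n → Subset n → ℕ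
testsUsed (answer A) D = 0
testsUsed (test S p q) D with meets S D
... | true  = suc (testsUsed p D)
... | false = suc (testsUsed q D)

data AllTestsSize {n : ℕ} (k : ℕ) : Alg n → Set where
  answer : ∀ {A} → AllTestsSize k (answer A)
  test   : ∀ {S p q} → ∣ S ∣ ≡ k → AllTestsSize k p → AllTestsSize k q →
           AllTestsSize k (test S p q)

Solves : ∀ {n} → ℕ → Alg n → Set
Solves {n} d T = (D : Subset n) → ∣ D ∣ ≡ d → output T D ≡ D

WorstCaseAtMost : ∀ {n} → ℕ → ℕ → Alg n → Set
WorstCaseAtMost {n} d m T = (D : Subset n) → ∣ D ∣ ≡ d → testsUsed T D ≤ m

-- M^[k](d,n) ≤ m  (false when M^[k](d,n) = ∞).
M≤ : (k d n m : ℕ) → Set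
M≤ k d n m = Σ (Alg n) λ T → AllTestsSize k T × Solves d T × WorstCaseAtMost d m T

-- Scan disjoint pairs {a , b} until one tests negative; its items are good, and one of them, g, is
-- kept. Each of the j earlier, positive pairs {a′ , b′} holds a defective, and the single test {a′ , g}
-- finds one: a′ if the test is positive (b′ then stays undecided), b′ otherwise.
-- The remaining e = d − j defectives among m undecided items are then found by testing pairs {a , b},
-- followed by {a , g} after each positive answer, which takes at most ⌈ m /2⌉ + 2e − 3 tests once
-- e ≥ 3; for e ≤ 2 the small overshoot is paid by the j ≥ 3 − e pairs already resolved. Counting the
-- j + 1 scanning and j resolving tests gives ⌈ n /2⌉ + 2d − 3. The scan must meet a negative pair,
-- since the ⌊ n /2⌋ pairs outnumber the defectives.
module Submission where

open import Defs
open import Data.Nat using (ℕ; zero; suc; _+_; _*_; _∸_; _≤_; _<_; z≤n; s≤s; ⌊_/2⌋; ⌈_/2⌉)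
open import Data.Nat.Properties
  using (≤-refl; ≤-reflexive; ≤-trans; n≤1+n; m≤n⇒m≤1+n; m≤m+n; m≤n+m; <⇒≱; +-monoʳ-≤; +-assoc; +-comm;
         +-identityʳ; +-suc; +-cancelˡ-≡; *-suc; +-∸-assoc; m+[n∸m]≡n; m+n≤o⇒m≤o∸n;
         ⌊n/2⌋-mono; ⌈n/2⌉-mono; ⌊n/2⌋≤⌈n/2⌉; module ≤-Reasoning)
open import Data.Nat.ListAction using (sum)
open import Data.Nat.ListAction.Properties using (sum-++; sum-↭)
open import Data.Nat.Tactic.RingSolver using (solve-∀)
open import Data.Bool using (Bool; true; false; _∨_; if_then_else_)
open import Data.Bool.Properties using (∨-identityʳ; ∨-idem; ∨-comm; ∨-conicalˡ; ∨-conicalʳ)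
open import Data.Fin using (Fin; zero; suc; _≟_)
open import Data.Fin.Subset using (Subset; ∣_∣; ⁅_⁆; inside; outside) renaming (⊥ to ∅)
open import Data.Fin.Subset.Properties using (∣⁅x⁆∣≡1)
open import Data.Vec using ([]; _∷_; lookup; _[_]≔_)
open import Data.Vec.Properties using (lookup∘update; lookup∘update′; tabulate∘lookup; tabulate-cong)
open import Data.List using (List; []; _∷_; _++_; length; map; tabulate; allFin)
open import Data.List.Properties using (map-++; map-tabulate; length-tabulate)
open import Data.List.Membership.Propositional using (_∉_)
open import Data.List.Membership.Propositional.Properties using (∈-allFin)
open import Data.List.Relation.Unary.All using (All; []; _∷_)
open import Data.List.Relation.Unary.Any using (here; there)
open import Data.List.Relation.Unary.AllPairs using (_∷_)
open import Data.List.Relation.Unary.Unique.Propositional using (Unique)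
open import Data.List.Relation.Unary.Unique.Propositional.Properties using (allFin⁺)
open import Data.List.Relation.Binary.Permutation.Propositional using (_↭_; ↭-sym; prep; ↭⇒↭ₛ)
open import Data.List.Relation.Binary.Permutation.Propositional.Properties using (∈-resp-↭; map⁺; shift; shifts)
import Data.List.Relation.Binary.Permutation.Setoid.Properties as PermutationSetoid
open import Data.Product using (_×_; _,_)
open import Function using (_∘_)
open import Relation.Nullary using (yes; no; contradiction)
open import Relation.Binary.PropositionalEquality
  using (_≡_; _≢_; refl; sym; trans; cong; cong₂; subst; ≢-sym)
open import Relation.Binary.PropositionalEquality.Properties using (setoid)

private variable
  A : Set
  n d e B B₁ B₂ B₃ : ℕ
  a b g : Fin n
  S D acc : Subset n
  U : List (Fin n)
  p q T₁ T₂ T₃ : Alg n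

pair : Fin n → Fin n → Subset n
pair zero    zero    = ⁅ zero ⁆
pair zero    (suc b) = inside ∷ ⁅ b ⁆
pair (suc a) zero    = inside ∷ ⁅ a ⁆
pair (suc a) (suc b) = outside ∷ pair a b

∣pair∣≡2 : a ≢ b → ∣ pair a b ∣ ≡ 2
∣pair∣≡2 {a = zero}  {b = zero}  a≢b = contradiction refl a≢b
∣pair∣≡2 {a = zero}  {b = suc b} _   = cong suc (∣⁅x⁆∣≡1 b)
∣pair∣≡2 {a = suc a} {b = zero}  _   = cong suc (∣⁅x⁆∣≡1 a)
∣pair∣≡2 {a = suc a} {b = suc b} a≢b = ∣pair∣≡2 (a≢b ∘ cong suc)

meets-∅ : (D : Subset n) → meets ∅ D ≡ false
meets-∅ []      = refl
meets-∅ (_ ∷ D) = meets-∅ D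

meets-⁅⁆ : (a : Fin n) (D : Subset n) → meets ⁅ a ⁆ D ≡ lookup D a
meets-⁅⁆ zero    (x ∷ D) = trans (cong (x ∨_) (meets-∅ D)) (∨-identityʳ x)
meets-⁅⁆ (suc a) (_ ∷ D) = meets-⁅⁆ a D

meets-pair : (a b : Fin n) (D : Subset n) → meets (pair a b) D ≡ lookup D a ∨ lookup D b
meets-pair zero    zero    (x ∷ D) = trans (meets-⁅⁆ zero (x ∷ D)) (sym (∨-idem x))
meets-pair zero    (suc b) (x ∷ D) = cong (x ∨_) (meets-⁅⁆ b D)
meets-pair (suc a) zero    (x ∷ D) = trans (cong (x ∨_) (meets-⁅⁆ a D)) (∨-comm x _)
meets-pair (suc a) (suc b) (_ ∷ D) = meets-pair a b D

output-test : output (test S p q) D ≡ output (if meets S D then p else q) D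
output-test {S = S} {D = D} with meets S D
... | true  = refl
... | false = refl

testsUsed-test : testsUsed (test S p q) D ≡ suc (testsUsed (if meets S D then p else q) D)
testsUsed-test {S = S} {D = D} with meets S D
... | true  = refl
... | false = refl

record Identifies (T : Alg n) (D : Subset n) (B : ℕ) : Set where
  constructor identifies
  field
    correct : output T D ≡ D
    within  : testsUsed T D ≤ B

open Identifies

identifies-answer : acc ≡ D → Identifies (answer acc) D B
identifies-answer acc≡D = identifies acc≡D z≤n

identifies-weaken : Identifies p D B₁ → B₁ ≤ B₂ → Identifies p D B₂
identifies-weaken (identifies correct within) B₁≤B₂ = identifies correct (≤-trans within B₁≤B₂)

identifies-test : Identifies (if meets S D then p else q) D B → Identifies (test S p q) D (suc B)
identifies-test {S = S} {p = p} {q = q} (identifies correct within) =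
  identifies (trans (output-test {S = S} {p = p} {q = q}) correct)
             (subst (_≤ _) (sym (testsUsed-test {S = S} {p = p} {q = q})) (s≤s within))

identifies-pair⁺ : lookup D a ∨ lookup D b ≡ true → Identifies p D B →
  Identifies (test (pair a b) p q) D (suc B)
identifies-pair⁺ {D = D} {a = a} {b = b} {p = p} {B = B} {q = q} a∨b h =
  identifies-test (subst (λ x → Identifies (if x then p else q) D B) (sym (trans (meets-pair a b D) a∨b)) h)

identifies-pair⁻ : lookup D a ≡ false → lookup D b ≡ false → Identifies q D B →
  Identifies (test (pair a b) p q) D (suc B)
identifies-pair⁻ {D = D} {a = a} {b = b} {q = q} {B = B} {p = p} a↦ b↦ h =
  identifies-test (subst (λ x → Identifies (if x then p else q) D B)
                         (sym (trans (meets-pair a b D) (cong₂ _∨_ a↦ b↦))) h)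

bit : Bool → ℕ
bit false = 0
bit true  = 1

defectives : Subset n → List (Fin n) → ℕ
defectives D xs = sum (map (bit ∘ lookup D) xs)

defectives-++ : (D : Subset n) (xs ys : List (Fin n)) →
  defectives D (xs ++ ys) ≡ defectives D xs + defectives D ys
defectives-++ D xs ys = trans (cong sum (map-++ (bit ∘ lookup D) xs ys)) (sum-++ (map (bit ∘ lookup D) xs) _)

defectives≤length : (D : Subset n) (xs : List (Fin n)) → defectives D xs ≤ length xs
defectives≤length D []       = z≤n
defectives≤length D (x ∷ xs) with lookup D x
... | true  = s≤s (defectives≤length D xs)
... | false = m≤n⇒m≤1+n (defectives≤length D xs)

defectives-allFin : (D : Subset n) → defectives D (allFin n) ≡ ∣ D ∣
defectives-allFin D = trans (cong sum (map-tabulate (λ i → i) (bit ∘ lookup D))) (sum-bits D)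
  where
  sum-bits : ∀ {m} (D : Subset m) → sum (tabulate (bit ∘ lookup D)) ≡ ∣ D ∣
  sum-bits []          = refl
  sum-bits (true ∷ D)  = cong suc (sum-bits D)
  sum-bits (false ∷ D) = sum-bits D

-- acc is the answer built so far and U the list of still undecided items.
record Consistent (D acc : Subset n) (U : List (Fin n)) (e : ℕ) : Set where
  field
    agrees-off : ∀ {i} → i ∉ U → lookup acc i ≡ lookup D i
    count      : defectives D U ≡ e

open Consistent

consistent-↭ : {U V : List (Fin n)} → U ↭ V → Consistent D acc U e → Consistent D acc V e
consistent-↭ {D = D} U↭V st = record
  { agrees-off = λ i∉V → agrees-off st (i∉V ∘ ∈-resp-↭ U↭V)
  ; count      = trans (sym (sum-↭ (map⁺ (bit ∘ lookup D) U↭V))) (count st)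
  }

consistent-[] : Consistent D acc [] e → acc ≡ D
consistent-[] {D = D} {acc = acc} st =
  trans (sym (tabulate∘lookup acc)) (trans (tabulate-cong (λ i → agrees-off st λ ())) (tabulate∘lookup D))

consistent-≤length : Consistent D acc U e → e ≤ length U
consistent-≤length {D = D} {U = U} st = subst (_≤ length U) (count st) (defectives≤length D U)

settle : ∀ {v} → Consistent D acc (a ∷ U) (bit v + e) → lookup D a ≡ v →
  Consistent D (acc [ a ]≔ v) U e
settle {D = D} {acc = acc} {a = a} {U = U} {v = v} st a↦v = record
  { agrees-off = agrees
  ; count      = +-cancelˡ-≡ (bit v) _ _ (trans (cong (λ x → bit x + defectives D U) (sym a↦v)) (count st))
  }
  where
  agrees : ∀ {i} → i ∉ U → lookup (acc [ a ]≔ v) i ≡ lookup D i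
  agrees {i} i∉U with i ≟ a
  ... | yes refl = trans (lookup∘update i acc v) (sym a↦v)
  ... | no  i≢a  = trans (lookup∘update′ i≢a acc v)
                         (agrees-off st λ { (here i≡a) → i≢a i≡a ; (there i∈U) → i∉U i∈U })

consistent-0⇒good : Consistent D acc (a ∷ U) 0 → lookup D a ≡ false
consistent-0⇒good {D = D} {a = a} st with lookup D a | count st
... | false | _  = refl
... | true  | ()

markGood : List (Fin n) → Subset n → Subset n
markGood []       acc = acc
markGood (a ∷ as) acc = markGood as (acc [ a ]≔ false)

markGood-correct : Consistent D acc U 0 → markGood U acc ≡ D
markGood-correct {U = []}    st = consistent-[] st
markGood-correct {U = _ ∷ _} st = markGood-correct (settle st (consistent-0⇒good st))

pairStep : Fin n → Fin n → Fin n → Alg n → Alg n → Alg n → Alg n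
pairStep a b g T₁ T₂ T₃ = test (pair a b) (test (pair a g) T₁ T₂) T₃

knownGood : ℕ → Fin n → List (Fin n) → Subset n → Alg n
knownGood zero          g pool               acc = answer (markGood pool acc)
knownGood (suc e)       g []                 acc = answer acc
knownGood 1             g (a ∷ [])           acc = answer (acc [ a ]≔ true)
knownGood 1             g (a ∷ b ∷ [])       acc =
  test (pair a g) (answer (acc [ a ]≔ true [ b ]≔ false)) (answer (acc [ a ]≔ false [ b ]≔ true))
knownGood 1             g (a ∷ b ∷ c ∷ rest) acc =
  pairStep a b g (knownGood 0 g (b ∷ c ∷ rest) (acc [ a ]≔ true))
                 (knownGood 0 g (c ∷ rest) (acc [ a ]≔ false [ b ]≔ true))
                 (knownGood 1 g (c ∷ rest) (acc [ a ]≔ false [ b ]≔ false))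
knownGood (suc (suc e)) g (a ∷ [])           acc = answer acc
knownGood (suc (suc e)) g (a ∷ b ∷ rest)     acc =
  pairStep a b g (knownGood (suc e) g (b ∷ rest) (acc [ a ]≔ true))
                 (knownGood (suc e) g rest (acc [ a ]≔ false [ b ]≔ true))
                 (knownGood (suc (suc e)) g rest (acc [ a ]≔ false [ b ]≔ false))

-- For e ≥ 3 this is ⌈ m /2⌉ + 2 * e ∸ 3.
knownGoodCost : ℕ → ℕ → ℕ
knownGoodCost 0 m = 0
knownGoodCost 1 m = ⌈ m /2⌉
knownGoodCost 2 m = 2 + ⌊ m /2⌋
knownGoodCost 3 m = 3 + ⌈ m /2⌉
knownGoodCost (suc e@(suc (suc (suc _)))) m = 2 + knownGoodCost e m

knownGoodCost-mono : ∀ e {m m′} → m ≤ m′ → knownGoodCost e m ≤ knownGoodCost e m′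
knownGoodCost-mono 0 _ = z≤n
knownGoodCost-mono 1 m≤m′ = ⌈n/2⌉-mono m≤m′
knownGoodCost-mono 2 m≤m′ = +-monoʳ-≤ 2 (⌊n/2⌋-mono m≤m′)
knownGoodCost-mono 3 m≤m′ = +-monoʳ-≤ 3 (⌈n/2⌉-mono m≤m′)
knownGoodCost-mono (suc e@(suc (suc (suc _)))) m≤m′ = +-monoʳ-≤ 2 (knownGoodCost-mono e m≤m′)

knownGoodCost-+2 : ∀ e m → knownGoodCost (suc e) (2 + m) ≡ suc (knownGoodCost (suc e) m)
knownGoodCost-+2 0 m = refl
knownGoodCost-+2 1 m = refl
knownGoodCost-+2 2 m = refl
knownGoodCost-+2 (suc e@(suc (suc _))) m = cong (2 +_) (knownGoodCost-+2 e m)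

knownGoodCost-step : ∀ e m → 2 + knownGoodCost (suc e) (suc m) ≤ knownGoodCost (2 + e) (2 + m)
knownGoodCost-step 0 m = ≤-refl
knownGoodCost-step 1 m = ≤-refl
knownGoodCost-step e@(suc (suc _)) m = +-monoʳ-≤ 2 (knownGoodCost-mono (suc e) (n≤1+n (suc m)))

⌈m+n/2⌉≤m+⌈n/2⌉ : ∀ m n → ⌈ m + n /2⌉ ≤ m + ⌈ n /2⌉
⌈m+n/2⌉≤m+⌈n/2⌉ zero    n = ≤-refl
⌈m+n/2⌉≤m+⌈n/2⌉ (suc m) n = s≤s (≤-trans (⌊n/2⌋≤⌈n/2⌉ (m + n)) (⌈m+n/2⌉≤m+⌈n/2⌉ m n))

knownGoodCost-bound : ∀ e j r → 3 ≤ e + j → 3 + knownGoodCost e (j + r) ≤ 2 * e + (j + ⌈ r /2⌉)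
knownGoodCost-bound 0 j r 3≤j = ≤-trans 3≤j (m≤m+n j _)
knownGoodCost-bound 1 (suc (suc j)) r _ = +-monoʳ-≤ 4 (⌈m+n/2⌉≤m+⌈n/2⌉ j r)
knownGoodCost-bound 2 (suc j) r _ = +-monoʳ-≤ 5 (⌈m+n/2⌉≤m+⌈n/2⌉ j r)
knownGoodCost-bound 3 j r _ = +-monoʳ-≤ 6 (⌈m+n/2⌉≤m+⌈n/2⌉ j r)
knownGoodCost-bound (suc e@(suc (suc (suc _)))) j r _ =
  subst (λ x → 3 + knownGoodCost (suc e) (j + r) ≤ x + (j + ⌈ r /2⌉)) (sym (*-suc 2 e))
        (+-monoʳ-≤ 2 (knownGoodCost-bound e j r (s≤s (s≤s (s≤s z≤n)))))
knownGoodCost-bound 1 0 r (s≤s ())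
knownGoodCost-bound 1 1 r (s≤s (s≤s ()))
knownGoodCost-bound 2 0 r (s≤s (s≤s ()))

pairStep-identifies : lookup D g ≡ false → Consistent D acc (a ∷ b ∷ U) (suc e) →
  (Consistent D (acc [ a ]≔ true) (b ∷ U) e → Identifies T₁ D B₁) →
  (Consistent D (acc [ a ]≔ false [ b ]≔ true) U e → Identifies T₂ D B₂) →
  (Consistent D (acc [ a ]≔ false [ b ]≔ false) U (suc e) → Identifies T₃ D B₃) →
  2 + B₁ ≤ B → 2 + B₂ ≤ B → 1 + B₃ ≤ B → Identifies (pairStep a b g T₁ T₂ T₃) D B
pairStep-identifies {D = D} {a = a} {b = b} g∉D st k₁ k₂ k₃ le₁ le₂ le₃ with lookup D a in a↦
... | true = identifies-weaken
  (identifies-pair⁺ (cong (_∨ _) a↦) (identifies-pair⁺ (cong (_∨ _) a↦) (k₁ (settle st a↦)))) le₁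
... | false with lookup D b in b↦
...   | true = identifies-weaken
  (identifies-pair⁺ (trans (cong (_∨ _) a↦) b↦) (identifies-pair⁻ a↦ g∉D (k₂ (settle (settle st a↦) b↦)))) le₂
...   | false = identifies-weaken
  (identifies-pair⁻ a↦ b↦ (k₃ (settle (settle st a↦) b↦))) le₃

knownGood-identifies : ∀ e g pool acc → lookup D g ≡ false → Consistent D acc pool e →
  Identifies (knownGood e g pool acc) D (knownGoodCost e (length pool))
knownGood-identifies zero g pool acc _ st = identifies-answer (markGood-correct st)
knownGood-identifies (suc e) g [] acc _ st = contradiction (consistent-≤length st) λ ()
knownGood-identifies {D = D} 1 g (a ∷ []) acc _ st with lookup D a in a↦
... | true  = identifies-answer (consistent-[] (settle st a↦))
... | false = contradiction (consistent-≤length (settle st a↦)) λ ()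
knownGood-identifies {D = D} 1 g (a ∷ b ∷ []) acc g∉D st with lookup D a in a↦
... | true  = identifies-pair⁺ (cong (_∨ _) a↦) (identifies-answer (consistent-[] (settle st₁ (consistent-0⇒good st₁))))
  where
  st₁ : Consistent D (acc [ a ]≔ true) (b ∷ []) 0
  st₁ = settle st a↦
... | false with lookup D b in b↦
...   | true  = identifies-pair⁻ a↦ g∉D (identifies-answer (consistent-[] (settle (settle st a↦) b↦)))
...   | false = contradiction (consistent-≤length (settle (settle st a↦) b↦)) λ ()
knownGood-identifies 1 g (a ∷ b ∷ c ∷ rest) acc g∉D st =
  pairStep-identifies g∉D st
    (knownGood-identifies 0 g (b ∷ c ∷ rest) _ g∉D)
    (knownGood-identifies 0 g (c ∷ rest) _ g∉D)
    (knownGood-identifies 1 g (c ∷ rest) _ g∉D)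
    (s≤s (s≤s z≤n)) (s≤s (s≤s z≤n)) ≤-refl
knownGood-identifies (suc (suc e)) g (a ∷ []) acc _ st = contradiction (consistent-≤length st) λ { (s≤s ()) }
knownGood-identifies (suc (suc e)) g (a ∷ b ∷ rest) acc g∉D st =
  pairStep-identifies g∉D st
    (knownGood-identifies (suc e) g (b ∷ rest) _ g∉D)
    (knownGood-identifies (suc e) g rest _ g∉D)
    (knownGood-identifies (suc (suc e)) g rest _ g∉D)
    (knownGoodCost-step e (length rest))
    (≤-trans (+-monoʳ-≤ 2 (knownGoodCost-mono (suc e) (n≤1+n _))) (knownGoodCost-step e (length rest)))
    (≤-reflexive (sym (knownGoodCost-+2 (suc e) (length rest))))

flatten : List (A × A) → List A
flatten []             = []
flatten ((a , b) ∷ ps) = a ∷ b ∷ flatten ps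

Positive : Subset n → Fin n × Fin n → Set
Positive D (a , b) = lookup D a ∨ lookup D b ≡ true

positives≤defectives : ∀ {ps} → All (Positive D) ps → length ps ≤ defectives D (flatten ps)
positives≤defectives []                                = z≤n
positives≤defectives {D = D} {ps = (a , b) ∷ _} (a∨b ∷ pos) =
  one-per-pair (lookup D a) (lookup D b) a∨b (positives≤defectives {D = D} pos)
  where
  one-per-pair : ∀ x y {m k} → x ∨ y ≡ true → m ≤ k → suc m ≤ bit x + (bit y + k)
  one-per-pair true  y     _ m≤k = s≤s (≤-trans m≤k (m≤n+m _ (bit y)))
  one-per-pair false true  _ m≤k = s≤s m≤k

-- Each pending pair (a , b) costs one test {a , g}: if a is good, b is the defective.
resolve : ℕ → Fin n → List (Fin n × Fin n) → List (Fin n) → Subset n → Alg n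
resolve e g []             pool acc = knownGood e g pool acc
resolve e g ((a , b) ∷ ps) pool acc =
  test (pair a g) (resolve e g ps (b ∷ pool) (acc [ a ]≔ true))
                  (resolve e g ps pool (acc [ a ]≔ false [ b ]≔ true))

resolve-identifies : ∀ e g pend pool acc → lookup D g ≡ false → All (Positive D) pend →
  Consistent D acc (flatten pend ++ pool) (length pend + e) →
  Identifies (resolve e g pend pool acc) D (length pend + knownGoodCost e (length pend + length pool))
resolve-identifies e g [] pool acc g∉D [] st = knownGood-identifies e g pool acc g∉D st
resolve-identifies {D = D} e g ((a , b) ∷ ps) pool acc g∉D (a∨b ∷ pos) st with lookup D a in a↦
... | true  = identifies-weaken (identifies-pair⁺ (cong (_∨ _) a↦) (resolve-identifies e g ps (b ∷ pool) _ g∉D pos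
                (consistent-↭ (↭-sym (shift b (flatten ps) pool)) (settle st a↦))))
                (≤-reflexive (cong (λ m → suc (length ps + knownGoodCost e m)) (+-suc (length ps) (length pool))))
... | false = identifies-weaken (identifies-pair⁻ a↦ g∉D (resolve-identifies e g ps pool _ g∉D pos
                (settle (settle st a↦) a∨b)))
                (s≤s (+-monoʳ-≤ (length ps) (knownGoodCost-mono e (n≤1+n _))))

pending≤defectives : ∀ {pend} rest → All (Positive D) pend →
  Consistent D acc (flatten pend ++ rest) d → length pend ≤ d
pending≤defectives {D = D} {pend = pend} rest pos st =
  ≤-trans (positives≤defectives {D = D} pos)
          (≤-trans (m≤m+n _ _) (≤-reflexive (trans (sym (defectives-++ D (flatten pend) rest)) (count st))))

resolve-within-budget : ∀ r {j d} → 3 ≤ d → j ≤ d →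
  j + knownGoodCost (d ∸ j) (j + r) ≤ ⌈ r /2⌉ + (2 * d ∸ 3)
resolve-within-budget r {j} {d} 3≤d j≤d = begin
  j + knownGoodCost k (j + r)  ≤⟨ m+n≤o⇒m≤o∸n _ total ⟩
  ⌈ r /2⌉ + 2 * d ∸ 3          ≡⟨ +-∸-assoc ⌈ r /2⌉ (≤-trans 3≤d (m≤m+n d _)) ⟩
  ⌈ r /2⌉ + (2 * d ∸ 3)        ∎
  where
  open ≤-Reasoning
  k : ℕ
  k = d ∸ j
  j+k≡d : j + k ≡ d
  j+k≡d = m+[n∸m]≡n j≤d
  total : j + knownGoodCost k (j + r) + 3 ≤ ⌈ r /2⌉ + 2 * d
  total = begin
    j + knownGoodCost k (j + r) + 3    ≡⟨ +-assoc j _ 3 ⟩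
    j + (knownGoodCost k (j + r) + 3)  ≡⟨ cong (j +_) (+-comm _ 3) ⟩
    j + (3 + knownGoodCost k (j + r))  ≤⟨ +-monoʳ-≤ j (knownGoodCost-bound k j r
                                            (subst (3 ≤_) (trans (sym j+k≡d) (+-comm j k)) 3≤d)) ⟩
    j + (2 * k + (j + ⌈ r /2⌉))        ≡⟨ regroup j k ⌈ r /2⌉ ⟩
    ⌈ r /2⌉ + 2 * (j + k)              ≡⟨ cong (λ x → ⌈ r /2⌉ + 2 * x) j+k≡d ⟩
    ⌈ r /2⌉ + 2 * d                    ∎
    where
    regroup : ∀ j e c → j + (2 * e + (j + c)) ≡ c + 2 * (j + e)
    regroup = solve-∀

-- The two answer clauses are never reached: that would need more positive pairs than defectives.
scan : ℕ → List (Fin n × Fin n) → List (Fin n) → Subset n → Alg n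
scan d pend []             acc = answer acc
scan d pend (_ ∷ [])       acc = answer acc
scan d pend (a ∷ b ∷ rest) acc =
  test (pair a b) (scan d ((a , b) ∷ pend) rest acc)
                  (resolve (d ∸ length pend) a pend rest (acc [ a ]≔ false [ b ]≔ false))

-- The j tests spent on the pending pairs are paid by ⌈ 2 * j + length rest /2⌉ = j + ⌈ length rest /2⌉.
scan-identifies : ∀ pend rest acc → 3 ≤ d → d < length pend + ⌊ length rest /2⌋ →
  All (Positive D) pend → Consistent D acc (flatten pend ++ rest) d →
  Identifies (scan d pend rest acc) D (⌈ length rest /2⌉ + (2 * d ∸ 3))
scan-identifies {d = d} pend [] acc _ d<pairs pos st =
  contradiction (pending≤defectives [] pos st) (<⇒≱ (subst (d <_) (+-identityʳ _) d<pairs))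
scan-identifies {d = d} pend (x ∷ []) acc _ d<pairs pos st =
  contradiction (pending≤defectives (x ∷ []) pos st) (<⇒≱ (subst (d <_) (+-identityʳ _) d<pairs))
scan-identifies {d = d} {D = D} pend (a ∷ b ∷ rest) acc 3≤d d<pairs pos st with lookup D a ∨ lookup D b in a∨b
... | true  = identifies-pair⁺ a∨b
  (scan-identifies ((a , b) ∷ pend) rest acc 3≤d (subst (d <_) (+-suc _ _) d<pairs) (a∨b ∷ pos)
                   (consistent-↭ (shifts (flatten pend) (a ∷ b ∷ [])) st))
... | false = identifies-pair⁻ a↦ b↦
  (identifies-weaken (resolve-identifies (d ∸ length pend) a pend rest _ a↦ pos st′)
                     (resolve-within-budget (length rest) 3≤d j≤d))
  where
  a↦ : lookup D a ≡ false
  a↦ = ∨-conicalˡ _ _ a∨b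
  b↦ : lookup D b ≡ false
  b↦ = ∨-conicalʳ _ _ a∨b
  j≤d : length pend ≤ d
  j≤d = pending≤defectives (a ∷ b ∷ rest) pos st
  st′ : Consistent D (acc [ a ]≔ false [ b ]≔ false) (flatten pend ++ rest) (length pend + (d ∸ length pend))
  st′ = subst (Consistent D _ _) (sym (m+[n∸m]≡n j≤d))
              (settle (settle (consistent-↭ (shifts (flatten pend) (a ∷ b ∷ [])) st) a↦) b↦)

unique-↭ : {xs ys : List (Fin n)} → xs ↭ ys → Unique xs → Unique ys
unique-↭ xs↭ys = PermutationSetoid.Unique-resp-↭ (setoid _) (↭⇒↭ₛ xs↭ys)

unique-drop₂ : ∀ {x y : A} {zs} → Unique (x ∷ y ∷ zs) → Unique (x ∷ zs)
unique-drop₂ ((_ ∷ x∉zs) ∷ (_ ∷ zs!)) = x∉zs ∷ zs!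

pairStep-size : a ≢ b → a ≢ g → AllTestsSize 2 T₁ → AllTestsSize 2 T₂ → AllTestsSize 2 T₃ →
  AllTestsSize 2 (pairStep a b g T₁ T₂ T₃)
pairStep-size a≢b a≢g s₁ s₂ s₃ = test (∣pair∣≡2 a≢b) (test (∣pair∣≡2 a≢g) s₁ s₂) s₃

knownGood-size : ∀ e g pool acc → Unique (g ∷ pool) → AllTestsSize 2 (knownGood {n} e g pool acc)
knownGood-size zero          g pool               acc _ = answer
knownGood-size (suc e)       g []                 acc _ = answer
knownGood-size 1             g (a ∷ [])           acc _ = answer
knownGood-size 1             g (a ∷ b ∷ [])       acc ((g≢a ∷ _) ∷ _) = test (∣pair∣≡2 (≢-sym g≢a)) answer answer
knownGood-size 1             g (a ∷ b ∷ c ∷ rest) acc u@((g≢a ∷ _) ∷ (a≢b ∷ _) ∷ _) =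
  pairStep-size a≢b (≢-sym g≢a)
    (knownGood-size 0 g (b ∷ c ∷ rest) _ (unique-drop₂ u))
    (knownGood-size 0 g (c ∷ rest) _ (unique-drop₂ (unique-drop₂ u)))
    (knownGood-size 1 g (c ∷ rest) _ (unique-drop₂ (unique-drop₂ u)))
knownGood-size (suc (suc e)) g (a ∷ [])           acc _ = answer
knownGood-size (suc (suc e)) g (a ∷ b ∷ rest)     acc u@((g≢a ∷ _) ∷ (a≢b ∷ _) ∷ _) =
  pairStep-size a≢b (≢-sym g≢a)
    (knownGood-size (suc e) g (b ∷ rest) _ (unique-drop₂ u))
    (knownGood-size (suc e) g rest _ (unique-drop₂ (unique-drop₂ u)))
    (knownGood-size (suc (suc e)) g rest _ (unique-drop₂ (unique-drop₂ u)))

resolve-size : ∀ e g pend pool acc → Unique (g ∷ flatten pend ++ pool) →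
  AllTestsSize 2 (resolve {n} e g pend pool acc)
resolve-size e g []             pool acc u = knownGood-size e g pool acc u
resolve-size e g ((a , b) ∷ ps) pool acc u@((g≢a ∷ _) ∷ _) =
  test (∣pair∣≡2 (≢-sym g≢a))
    (resolve-size e g ps (b ∷ pool) _ (unique-↭ (prep g (↭-sym (shift b (flatten ps) pool))) (unique-drop₂ u)))
    (resolve-size e g ps pool _ (unique-drop₂ (unique-drop₂ u)))

scan-size : ∀ d pend rest acc → Unique (flatten pend ++ rest) → AllTestsSize 2 (scan {n} d pend rest acc)
scan-size d pend []             acc _ = answer
scan-size d pend (_ ∷ [])       acc _ = answer
scan-size d pend (a ∷ b ∷ rest) acc u with unique-↭ (shifts (flatten pend) (a ∷ b ∷ [])) u
... | u′@((a≢b ∷ _) ∷ _) =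
  test (∣pair∣≡2 a≢b) (scan-size d ((a , b) ∷ pend) rest acc u′)
                      (resolve-size _ a pend rest _ (unique-drop₂ u′))

m≤n∸1⇒m<n : ∀ {m n} → 1 ≤ m → m ≤ n ∸ 1 → m < n
m≤n∸1⇒m<n {n = suc n} _       m≤n = s≤s m≤n
m≤n∸1⇒m<n {n = zero}  (s≤s _) ()

theorem3 : (n d : ℕ) → 3 ≤ d → d ≤ ⌊ n /2⌋ ∸ 1 →
    M≤ 2 d n (⌈ n /2⌉ + 2 * d ∸ 3)
theorem3 n d 3≤d d≤⌊n/2⌋∸1 =
  scan d [] (allFin n) ∅ , scan-size d [] (allFin n) ∅ (allFin⁺ n) ,
  (λ D ∣D∣≡d → correct (scan-solves D ∣D∣≡d)) ,
  (λ D ∣D∣≡d → ≤-trans (within (scan-solves D ∣D∣≡d)) (≤-reflexive budget≡))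
  where
  length-allFin : length (allFin n) ≡ n
  length-allFin = length-tabulate (λ i → i)

  budget≡ : ⌈ length (allFin n) /2⌉ + (2 * d ∸ 3) ≡ ⌈ n /2⌉ + 2 * d ∸ 3
  budget≡ = trans (cong (λ m → ⌈ m /2⌉ + (2 * d ∸ 3)) length-allFin)
                  (sym (+-∸-assoc ⌈ n /2⌉ (≤-trans 3≤d (m≤m+n d _))))

  initially-consistent : (D : Subset n) → ∣ D ∣ ≡ d → Consistent D ∅ (allFin n) d
  initially-consistent D ∣D∣≡d = record
    { agrees-off = λ {i} i∉allFin → contradiction (∈-allFin i) i∉allFin
    ; count      = trans (defectives-allFin D) ∣D∣≡d
    }

  scan-solves : (D : Subset n) → ∣ D ∣ ≡ d →
    Identifies (scan d [] (allFin n) ∅) D (⌈ length (allFin n) /2⌉ + (2 * d ∸ 3))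
  scan-solves D ∣D∣≡d =
    scan-identifies [] (allFin n) ∅ 3≤d
      (subst (λ m → d < ⌊ m /2⌋) (sym length-allFin) (m≤n∸1⇒m<n (≤-trans (s≤s z≤n) 3≤d) d≤⌊n/2⌋∸1))
      [] (initially-consistent D ∣D∣≡d)
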